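{- Let $\mathcal{C}$ be a category with cofibrations and an interval satisfying the general conditions (G1)–(G7) below, and let $\mathrm{El}\colon\tilde U\to U$ be a homotopical universe. Suppose that $m\colon A\to B$ is a cofibration which is a monomorphism, $A$ and $B$ are $U$-small objects, and $B$ is discrete. Then $m$ is a $U$-small fibration and furthermore an hproposition.
   Context: $\mathcal{C}$ is locally cartesian closed with finite colimits, with cofibrations and an interval $\delta_0,\delta_1\colon1\to\mathbb{I}$. Trivial fibrations: maps with the right lifting property (RLP) against all cofibrations; fibrations: maps with the RLP against $\delta_0\hat\times m$, $\delta_1\hat\times m$ for cofibrations $m$ ($\hat\times$ the pushout product). (G1) cofibrations closed under pullback; (G2) closed under binary unions; (G3) $\mathbb{I}$ has connections $\wedge,\vee$ with $0\wedge i=i\wedge0=0$, $1\wedge i=i\wedge1=i$, $0\vee i=i\vee0=i$, $1\vee i=i\vee1=1$; (G4) $\delta_0,\delta_1$ disjoint; (G5) $\delta_0,\delta_1$ cofibrations; (G6) every map factors as cofibration followed by trivial fibration; (G7) every $0\to X$ is a cofibration. $r^X\colon X\to X^{\mathbb{I}}$ is the constant-path map; $X$ is discrete if $r^X$ is an isomorphism. For $f\colon X\to Y$, $P_Y(X)$ is the pullback of $f^{\mathbb{I}}$ along $r^Y$, with induced $P_Y(X)\to X\times_YX$; $f$ is an hproposition if it is a fibration and this map is a trivial fibration. Given $\mathrm{El}\colon\tilde U\to U$, a map is $U$-small if it is a pullback of $\mathrm{El}$, an object $X$ is $U$-small if $X\to1$ is. $\mathrm{El}$ is a universe if isomorphisms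 are $U$-small and $U$-small maps are closed under composition, dependent products, binary coproducts and mapping path spaces; it is homotopical if moreover $\mathrm{El}$ is a fibration and $U$ is fibrant. -}

module Defs where

open import Level using (Level; _⊔_) renaming (suc to lsuc)
open import Data.Product using (Σ; _×_; _,_; proj₁; proj₂; Σ-syntax)
open import Relation.Binary.PropositionalEquality
  using (_≡_; refl; sym; trans; cong; cong₂; module ≡-Reasoning)

record Category (o ℓ : Level) : Set (lsuc (o ⊔ ℓ)) where
  infixr 9 _∘_
  infix 4 _⇒_
  field
    Obj       : Set o
    _⇒_       : Obj → Obj → Set ℓ
    id        : ∀ {A} → A ⇒ A
    _∘_       : ∀ {A B C} → B ⇒ C → A ⇒ B → A ⇒ C
    identityˡ : ∀ {A B} {f : A ⇒ B} → id ∘ f ≡ f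
    identityʳ : ∀ {A B} {f : A ⇒ B} → f ∘ id ≡ f
    assoc     : ∀ {A B C D} {f : A ⇒ B} {g : B ⇒ C} {h : C ⇒ D} →
                (h ∘ g) ∘ f ≡ h ∘ (g ∘ f)

module _ {o ℓ} (𝒞 : Category o ℓ) where
  open Category 𝒞

  IsIso : ∀ {A B} → A ⇒ B → Set ℓ
  IsIso {A} {B} f = Σ[ g ∈ B ⇒ A ] (g ∘ f ≡ id × f ∘ g ≡ id)

  Mono : ∀ {A B} → A ⇒ B → Set (o ⊔ ℓ)
  Mono {A} f = ∀ {Z} (g h : Z ⇒ A) → f ∘ g ≡ f ∘ h → g ≡ h

  record IsTerminal (T : Obj) : Set (o ⊔ ℓ) where
    field
      !        : ∀ {X} → X ⇒ T
      !-unique : ∀ {X} (f g : X ⇒ T) → f ≡ g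

  record IsInitial (Z : Obj) : Set (o ⊔ ℓ) where
    field
      ¡        : ∀ {X} → Z ⇒ X
      ¡-unique : ∀ {X} (f g : Z ⇒ X) → f ≡ g

  record IsPullback {P X Y Z : Obj} (f : X ⇒ Z) (g : Y ⇒ Z)
                    (p₁ : P ⇒ X) (p₂ : P ⇒ Y) : Set (o ⊔ ℓ) where
    field
      commute      : f ∘ p₁ ≡ g ∘ p₂
      universal    : ∀ {W} (a : W ⇒ X) (b : W ⇒ Y) → f ∘ a ≡ g ∘ b →
                     Σ[ u ∈ W ⇒ P ] (p₁ ∘ u ≡ a × p₂ ∘ u ≡ b)
      jointly-mono : ∀ {W} (u v : W ⇒ P) → p₁ ∘ u ≡ p₁ ∘ v → p₂ ∘ u ≡ p₂ ∘ v → u ≡ v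

  record IsPushout {Z X Y Q : Obj} (f : Z ⇒ X) (g : Z ⇒ Y)
                   (i₁ : X ⇒ Q) (i₂ : Y ⇒ Q) : Set (o ⊔ ℓ) where
    field
      commute     : i₁ ∘ f ≡ i₂ ∘ g
      universal   : ∀ {W} (a : X ⇒ W) (b : Y ⇒ W) → a ∘ f ≡ b ∘ g →
                    Σ[ u ∈ Q ⇒ W ] (u ∘ i₁ ≡ a × u ∘ i₂ ≡ b)
      jointly-epi : ∀ {W} (u v : Q ⇒ W) → u ∘ i₁ ≡ v ∘ i₁ → u ∘ i₂ ≡ v ∘ i₂ → u ≡ v

  record Product (X Y : Obj) : Set (o ⊔ ℓ) where
    field
      obj          : Obj
      π₁           : obj ⇒ X
      π₂           : obj ⇒ Y
      ⟨_,_⟩        : ∀ {W} → W ⇒ X → W ⇒ Y → W ⇒ obj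
      π₁∘⟨⟩        : ∀ {W} {a : W ⇒ X} {b : W ⇒ Y} → π₁ ∘ ⟨ a , b ⟩ ≡ a
      π₂∘⟨⟩        : ∀ {W} {a : W ⇒ X} {b : W ⇒ Y} → π₂ ∘ ⟨ a , b ⟩ ≡ b
      jointly-mono : ∀ {W} (u v : W ⇒ obj) → π₁ ∘ u ≡ π₁ ∘ v → π₂ ∘ u ≡ π₂ ∘ v → u ≡ v

  record Pullback {X Y Z : Obj} (f : X ⇒ Z) (g : Y ⇒ Z) : Set (o ⊔ ℓ) where
    field
      P          : Obj
      p₁         : P ⇒ X
      p₂         : P ⇒ Y
      isPullback : IsPullback f g p₁ p₂

  record Pushout {Z X Y : Obj} (f : Z ⇒ X) (g : Z ⇒ Y) : Set (o ⊔ ℓ) where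
    field
      Q         : Obj
      i₁        : X ⇒ Q
      i₂        : Y ⇒ Q
      isPushout : IsPushout f g i₁ i₂

  _⧄_ : ∀ {A B X Y} → A ⇒ B → X ⇒ Y → Set ℓ
  _⧄_ {A} {B} {X} {Y} i p =
    (u : A ⇒ X) (v : B ⇒ Y) → p ∘ u ≡ v ∘ i →
    Σ[ d ∈ B ⇒ X ] (d ∘ i ≡ u × p ∘ d ≡ v)

  record FinLimColim : Set (o ⊔ ℓ) where
    field
      𝟙          : Obj
      𝟙-terminal : IsTerminal 𝟙
      product    : ∀ X Y → Product X Y
      pullback   : ∀ {X Y Z} (f : X ⇒ Z) (g : Y ⇒ Z) → Pullback f g
      𝟘          : Obj
      𝟘-initial  : IsInitial 𝟘
      pushout    : ∀ {Z X Y} (f : Z ⇒ X) (g : Z ⇒ Y) → Pushout f g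

module LimOps {o ℓ} {𝒞 : Category o ℓ} (L : FinLimColim 𝒞) where
  open Category 𝒞
  open FinLimColim L public using (𝟙; 𝟘)
  open ≡-Reasoning

  ! : ∀ {X} → X ⇒ 𝟙
  ! = IsTerminal.! (FinLimColim.𝟙-terminal L)

  ¡ : ∀ {X} → 𝟘 ⇒ X
  ¡ = IsInitial.¡ (FinLimColim.𝟘-initial L)

  infixr 7 _×₀_
  _×₀_ : Obj → Obj → Obj
  X ×₀ Y = Product.obj (FinLimColim.product L X Y)

  π₁ : ∀ {X Y} → X ×₀ Y ⇒ X
  π₁ {X} {Y} = Product.π₁ (FinLimColim.product L X Y)

  π₂ : ∀ {X Y} → X ×₀ Y ⇒ Y
  π₂ {X} {Y} = Product.π₂ (FinLimColim.product L X Y)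

  ⟨_,_⟩ : ∀ {W X Y} → W ⇒ X → W ⇒ Y → W ⇒ X ×₀ Y
  ⟨_,_⟩ {W} {X} {Y} = Product.⟨_,_⟩ (FinLimColim.product L X Y)

  infixr 8 _⊗_
  _⊗_ : ∀ {A B C D} → A ⇒ B → C ⇒ D → A ×₀ C ⇒ B ×₀ D
  f ⊗ g = ⟨ f ∘ π₁ , g ∘ π₂ ⟩

  PB : ∀ {X Y Z} (f : X ⇒ Z) (g : Y ⇒ Z) → Obj
  PB f g = Pullback.P (FinLimColim.pullback L f g)

  pb₁ : ∀ {X Y Z} {f : X ⇒ Z} {g : Y ⇒ Z} → PB f g ⇒ X
  pb₁ {f = f} {g} = Pullback.p₁ (FinLimColim.pullback L f g)

  pb₂ : ∀ {X Y Z} {f : X ⇒ Z} {g : Y ⇒ Z} → PB f g ⇒ Y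
  pb₂ {f = f} {g} = Pullback.p₂ (FinLimColim.pullback L f g)

  pb-isPullback : ∀ {X Y Z} (f : X ⇒ Z) (g : Y ⇒ Z) → IsPullback 𝒞 f g (pb₁ {f = f} {g}) pb₂
  pb-isPullback f g = Pullback.isPullback (FinLimColim.pullback L f g)

  pb⟨_,_⟩[_] : ∀ {W X Y Z} {f : X ⇒ Z} {g : Y ⇒ Z} (a : W ⇒ X) (b : W ⇒ Y) →
               f ∘ a ≡ g ∘ b → W ⇒ PB f g
  pb⟨_,_⟩[_] {f = f} {g} a b e = proj₁ (IsPullback.universal (pb-isPullback f g) a b e)

  PO : ∀ {Z X Y} (f : Z ⇒ X) (g : Z ⇒ Y) → Obj
  PO f g = Pushout.Q (FinLimColim.pushout L f g)

  po₁ : ∀ {Z X Y} {f : Z ⇒ X} {g : Z ⇒ Y} → X ⇒ PO f g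
  po₁ {f = f} {g} = Pushout.i₁ (FinLimColim.pushout L f g)

  po₂ : ∀ {Z X Y} {f : Z ⇒ X} {g : Z ⇒ Y} → Y ⇒ PO f g
  po₂ {f = f} {g} = Pushout.i₂ (FinLimColim.pushout L f g)

  po-isPushout : ∀ {Z X Y} (f : Z ⇒ X) (g : Z ⇒ Y) → IsPushout 𝒞 f g (po₁ {f = f} {g}) po₂
  po-isPushout f g = Pushout.isPushout (FinLimColim.pushout L f g)

  po[_,_][_] : ∀ {Z X Y W} {f : Z ⇒ X} {g : Z ⇒ Y} (a : X ⇒ W) (b : Y ⇒ W) →
               a ∘ f ≡ b ∘ g → PO f g ⇒ W
  po[_,_][_] {f = f} {g} a b e = proj₁ (IsPushout.universal (po-isPushout f g) a b e)

  infixr 6 _+₀_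
  _+₀_ : Obj → Obj → Obj
  X +₀ Y = PO (¡ {X}) (¡ {Y})

  [_,_] : ∀ {X Y Z} → X ⇒ Z → Y ⇒ Z → X +₀ Y ⇒ Z
  [ f , g ] = po[ f , g ][ IsInitial.¡-unique (FinLimColim.𝟘-initial L) _ _ ]

  ⟨⟩∘ : ∀ {V W X Y} {a : W ⇒ X} {b : W ⇒ Y} {h : V ⇒ W} →
        ⟨ a , b ⟩ ∘ h ≡ ⟨ a ∘ h , b ∘ h ⟩
  ⟨⟩∘ {X = X} {Y} {a} {b} {h} =
    Product.jointly-mono (FinLimColim.product L X Y) _ _
      (trans (sym assoc) (trans (cong (_∘ h) (Product.π₁∘⟨⟩ (FinLimColim.product L X Y)))
                                (sym (Product.π₁∘⟨⟩ (FinLimColim.product L X Y)))))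
      (trans (sym assoc) (trans (cong (_∘ h) (Product.π₂∘⟨⟩ (FinLimColim.product L X Y)))
                                (sym (Product.π₂∘⟨⟩ (FinLimColim.product L X Y)))))

  π₁∘⟨⟩ : ∀ {W X Y} {a : W ⇒ X} {b : W ⇒ Y} → π₁ ∘ ⟨ a , b ⟩ ≡ a
  π₁∘⟨⟩ {X = X} {Y} = Product.π₁∘⟨⟩ (FinLimColim.product L X Y)

  π₂∘⟨⟩ : ∀ {W X Y} {a : W ⇒ X} {b : W ⇒ Y} → π₂ ∘ ⟨ a , b ⟩ ≡ b
  π₂∘⟨⟩ {X = X} {Y} = Product.π₂∘⟨⟩ (FinLimColim.product L X Y)

  ⊗∘⊗ : ∀ {A₁ A₂ A₃ B₁ B₂ B₃} {f : A₂ ⇒ A₃} {g : B₂ ⇒ B₃} {h : A₁ ⇒ A₂} {k : B₁ ⇒ B₂} →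
        (f ⊗ g) ∘ (h ⊗ k) ≡ (f ∘ h) ⊗ (g ∘ k)
  ⊗∘⊗ {f = f} {g} {h} {k} = trans ⟨⟩∘ (cong₂ ⟨_,_⟩
    (trans assoc (trans (cong (f ∘_) π₁∘⟨⟩) (sym assoc)))
    (trans assoc (trans (cong (g ∘_) π₂∘⟨⟩) (sym assoc))))

  ×̂-square : ∀ {X Y A B} (f : X ⇒ Y) (m : A ⇒ B) →
             (id ⊗ m) ∘ (f ⊗ id) ≡ (f ⊗ id) ∘ (id ⊗ m)
  ×̂-square f m = trans ⊗∘⊗ (trans (cong₂ _⊗_ (trans identityˡ (sym identityʳ))
                                            (trans identityʳ (sym identityˡ)))
                                   (sym ⊗∘⊗))

  infixr 8 _×̂_
  _×̂_ : ∀ {X Y A B} (f : X ⇒ Y) (m : A ⇒ B) →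
        PO (f ⊗ id {A}) (id {X} ⊗ m) ⇒ Y ×₀ B
  f ×̂ m = po[ id ⊗ m , f ⊗ id ][ ×̂-square f m ]

module _ {o ℓ} {𝒞 : Category o ℓ} (L : FinLimColim 𝒞) where
  open Category 𝒞
  open LimOps L

  record Exponential (X Y : Obj) : Set (o ⊔ ℓ) where
    field
      obj    : Obj
      eval   : obj ×₀ Y ⇒ X
      curry  : ∀ {W} → W ×₀ Y ⇒ X → W ⇒ obj
      β      : ∀ {W} {h : W ×₀ Y ⇒ X} → eval ∘ (curry h ⊗ id) ≡ h
      unique : ∀ {W} {h : W ×₀ Y ⇒ X} (t : W ⇒ obj) → eval ∘ (t ⊗ id) ≡ h → t ≡ curry h

  pbMap : ∀ {W Π Y Z} {q : W ⇒ Z} {π : Π ⇒ Z} (g : Y ⇒ Z) (t : W ⇒ Π) →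
          π ∘ t ≡ q → PB q g ⇒ PB π g
  pbMap {q = q} {π} g t e =
    pb⟨ t ∘ pb₁ , pb₂ ⟩[ trans (sym assoc)
                          (trans (cong (_∘ pb₁) e) (IsPullback.commute (pb-isPullback q g))) ]

  -- dependent product  Π_g p  of  p : X → Y  along  g : Y → Z
  -- (right adjoint to pullback along g, described by its universal property)
  record DepProduct {X Y Z : Obj} (p : X ⇒ Y) (g : Y ⇒ Z) : Set (o ⊔ ℓ) where
    field
      obj       : Obj
      π         : obj ⇒ Z
      ev        : PB π g ⇒ X
      ev-over   : p ∘ ev ≡ pb₂
      transpose : ∀ {W} (q : W ⇒ Z) (h : PB q g ⇒ X) → p ∘ h ≡ pb₂ → W ⇒ obj
      transpose-over : ∀ {W} (q : W ⇒ Z) (h : PB q g ⇒ X) (e : p ∘ h ≡ pb₂) →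
                       π ∘ transpose q h e ≡ q
      transpose-β    : ∀ {W} (q : W ⇒ Z) (h : PB q g ⇒ X) (e : p ∘ h ≡ pb₂) →
                       ev ∘ pbMap g (transpose q h e) (transpose-over q h e) ≡ h
      transpose-unique : ∀ {W} (q : W ⇒ Z) (h : PB q g ⇒ X) (e : p ∘ h ≡ pb₂)
                         (t : W ⇒ obj) (e' : π ∘ t ≡ q) →
                         ev ∘ pbMap g t e' ≡ h → t ≡ transpose q h e

  record LCC : Set (o ⊔ ℓ) where
    field
      exponential : ∀ X Y → Exponential X Y
      depProduct  : ∀ {X Y Z} (p : X ⇒ Y) (g : Y ⇒ Z) → DepProduct p g

  record Interval : Set (o ⊔ ℓ) where
    field
      𝕀  : Obj
      δ₀ : 𝟙 ⇒ 𝕀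
      δ₁ : 𝟙 ⇒ 𝕀
      ∧  : 𝕀 ×₀ 𝕀 ⇒ 𝕀
      ∨  : 𝕀 ×₀ 𝕀 ⇒ 𝕀

record Setting (o ℓ c : Level) : Set (lsuc (o ⊔ ℓ ⊔ c)) where
  field
    𝒞        : Category o ℓ
    L        : FinLimColim 𝒞
    E        : LCC L
    Int      : Interval L
    Cof      : ∀ {A B} → Category._⇒_ 𝒞 A B → Set c

module _ {o ℓ c} (S : Setting o ℓ c) where
  open Setting S
  open Category 𝒞
  open LimOps L
  open Interval Int
  open ≡-Reasoning

  Ob : Set o
  Ob = Obj

  Hom : Ob → Ob → Set ℓ
  Hom = _⇒_

  Cofibration : ∀ {A B} → Hom A B → Set c
  Cofibration = Cof

  TrivFib : ∀ {X Y} → Hom X Y → Set (o ⊔ ℓ ⊔ c)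
  TrivFib p = ∀ {A B} (m : A ⇒ B) → Cof m → _⧄_ 𝒞 m p

  IsFib : ∀ {X Y} → Hom X Y → Set (o ⊔ ℓ ⊔ c)
  IsFib p = ∀ {A B} (m : A ⇒ B) → Cof m → _⧄_ 𝒞 (δ₀ ×̂ m) p × _⧄_ 𝒞 (δ₁ ×̂ m) p

  _^𝕀 : Ob → Ob
  X ^𝕀 = Exponential.obj (LCC.exponential E X 𝕀)

  evalI : ∀ {X} → X ^𝕀 ×₀ 𝕀 ⇒ X
  evalI {X} = Exponential.eval (LCC.exponential E X 𝕀)

  curryI : ∀ {W X} → W ×₀ 𝕀 ⇒ X → W ⇒ X ^𝕀
  curryI {X = X} = Exponential.curry (LCC.exponential E X 𝕀)

  r : ∀ X → X ⇒ X ^𝕀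
  r X = curryI (π₁ {X} {𝕀})

  Discrete : Ob → Set ℓ
  Discrete X = IsIso 𝒞 (r X)

  _^𝕀₁ : ∀ {X Y} → X ⇒ Y → X ^𝕀 ⇒ Y ^𝕀
  f ^𝕀₁ = curryI (f ∘ evalI)

  ev₀ ev₁ : ∀ {X} → X ^𝕀 ⇒ X
  ev₀ = evalI ∘ ⟨ id , δ₀ ∘ ! ⟩
  ev₁ = evalI ∘ ⟨ id , δ₁ ∘ ! ⟩

  private
    curryI-β : ∀ {W X} {h : W ×₀ 𝕀 ⇒ X} → evalI ∘ (curryI h ⊗ id) ≡ h
    curryI-β {X = X} = Exponential.β (LCC.exponential E X 𝕀)

    ⊗id∘⟨id,⟩ : ∀ {W V} {t : W ⇒ V} {c : W ⇒ 𝕀} → (t ⊗ id) ∘ ⟨ id , c ⟩ ≡ ⟨ t , c ⟩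
    ⊗id∘⟨id,⟩ {t = t} {c} = trans ⟨⟩∘ (cong₂ ⟨_,_⟩
      (trans assoc (trans (cong (t ∘_) π₁∘⟨⟩) identityʳ))
      (trans assoc (trans (cong (id ∘_) π₂∘⟨⟩) identityˡ)))

    eval-curry : ∀ {W X} {h : W ×₀ 𝕀 ⇒ X} {c : W ⇒ 𝕀} →
                 evalI ∘ ⟨ curryI h , c ⟩ ≡ h ∘ ⟨ id , c ⟩
    eval-curry {h = h} {c} = begin
      evalI ∘ ⟨ curryI h , c ⟩              ≡⟨ cong (evalI ∘_) (sym ⊗id∘⟨id,⟩) ⟩
      evalI ∘ ((curryI h ⊗ id) ∘ ⟨ id , c ⟩) ≡⟨ sym assoc ⟩
      (evalI ∘ (curryI h ⊗ id)) ∘ ⟨ id , c ⟩ ≡⟨ cong (_∘ ⟨ id , c ⟩) curryI-β ⟩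
      h ∘ ⟨ id , c ⟩                        ∎

    const-∘ : ∀ {V W} {d : 𝟙 ⇒ 𝕀} {t : V ⇒ W} → (d ∘ !) ∘ t ≡ d ∘ !
    const-∘ {d = d} {t} = trans assoc
      (cong (d ∘_) (IsTerminal.!-unique (FinLimColim.𝟙-terminal L) _ _))

    ev-nat : ∀ {X Y} {f : X ⇒ Y} (d : 𝟙 ⇒ 𝕀) →
             (evalI ∘ ⟨ id , d ∘ ! ⟩) ∘ (f ^𝕀₁) ≡ f ∘ (evalI ∘ ⟨ id , d ∘ ! ⟩)
    ev-nat {f = f} d = begin
      (evalI ∘ ⟨ id , d ∘ ! ⟩) ∘ (f ^𝕀₁)        ≡⟨ assoc ⟩
      evalI ∘ (⟨ id , d ∘ ! ⟩ ∘ (f ^𝕀₁))        ≡⟨ cong (evalI ∘_) ⟨⟩∘ ⟩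
      evalI ∘ ⟨ id ∘ (f ^𝕀₁) , (d ∘ !) ∘ (f ^𝕀₁) ⟩
        ≡⟨ cong (evalI ∘_) (cong₂ ⟨_,_⟩ identityˡ const-∘) ⟩
      evalI ∘ ⟨ f ^𝕀₁ , d ∘ ! ⟩                 ≡⟨ eval-curry ⟩
      (f ∘ evalI) ∘ ⟨ id , d ∘ ! ⟩              ≡⟨ assoc ⟩
      f ∘ (evalI ∘ ⟨ id , d ∘ ! ⟩)              ∎

    ev-r : ∀ {Y} (d : 𝟙 ⇒ 𝕀) → (evalI ∘ ⟨ id , d ∘ ! ⟩) ∘ r Y ≡ id
    ev-r {Y} d = begin
      (evalI ∘ ⟨ id , d ∘ ! ⟩) ∘ r Y            ≡⟨ assoc ⟩
      evalI ∘ (⟨ id , d ∘ ! ⟩ ∘ r Y)            ≡⟨ cong (evalI ∘_) ⟨⟩∘ ⟩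
      evalI ∘ ⟨ id ∘ r Y , (d ∘ !) ∘ r Y ⟩
        ≡⟨ cong (evalI ∘_) (cong₂ ⟨_,_⟩ identityˡ const-∘) ⟩
      evalI ∘ ⟨ r Y , d ∘ ! ⟩                   ≡⟨ eval-curry ⟩
      π₁ ∘ ⟨ id , d ∘ ! ⟩                       ≡⟨ π₁∘⟨⟩ ⟩
      id                                        ∎

    endpoint : ∀ {P X Y} {f : X ⇒ Y} {q₁ : P ⇒ X ^𝕀} {q₂ : P ⇒ Y} (d : 𝟙 ⇒ 𝕀) →
               (f ^𝕀₁) ∘ q₁ ≡ r Y ∘ q₂ → f ∘ ((evalI ∘ ⟨ id , d ∘ ! ⟩) ∘ q₁) ≡ q₂
    endpoint {Y = Y} {f} {q₁} {q₂} d e = begin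
      f ∘ ((evalI ∘ ⟨ id , d ∘ ! ⟩) ∘ q₁)       ≡⟨ sym assoc ⟩
      (f ∘ (evalI ∘ ⟨ id , d ∘ ! ⟩)) ∘ q₁       ≡⟨ cong (_∘ q₁) (sym (ev-nat d)) ⟩
      ((evalI ∘ ⟨ id , d ∘ ! ⟩) ∘ (f ^𝕀₁)) ∘ q₁ ≡⟨ assoc ⟩
      (evalI ∘ ⟨ id , d ∘ ! ⟩) ∘ ((f ^𝕀₁) ∘ q₁) ≡⟨ cong ((evalI ∘ ⟨ id , d ∘ ! ⟩) ∘_) e ⟩
      (evalI ∘ ⟨ id , d ∘ ! ⟩) ∘ (r Y ∘ q₂)     ≡⟨ sym assoc ⟩
      ((evalI ∘ ⟨ id , d ∘ ! ⟩) ∘ r Y) ∘ q₂     ≡⟨ cong (_∘ q₂) (ev-r d) ⟩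
      id ∘ q₂                                   ≡⟨ identityˡ ⟩
      q₂                                        ∎

  PathObj : ∀ {X Y} → X ⇒ Y → Ob
  PathObj {X} {Y} f = PB (f ^𝕀₁) (r Y)

  pathMap : ∀ {X Y} (f : X ⇒ Y) → PathObj f ⇒ PB f f
  pathMap {X} {Y} f =
    pb⟨ ev₀ ∘ pb₁ , ev₁ ∘ pb₁ ⟩[ trans (endpoint δ₀ comm) (sym (endpoint δ₁ comm)) ]
    where comm = IsPullback.commute (pb-isPullback (f ^𝕀₁) (r Y))

  IsHProp : ∀ {X Y} → X ⇒ Y → Set (o ⊔ ℓ ⊔ c)
  IsHProp f = IsFib f × TrivFib (pathMap f)

  record GeneralConditions : Set (o ⊔ ℓ ⊔ c) where
    field
      G1 : ∀ {P X A B} (f : X ⇒ B) (m : A ⇒ B) (p₁ : P ⇒ X) (p₂ : P ⇒ A) →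
           IsPullback 𝒞 f m p₁ p₂ → Cof m → Cof p₁
      G2 : ∀ {A B X} (m : A ⇒ X) (n : B ⇒ X) → Cof m → Cof n →
           Cof (po[ m , n ][ IsPullback.commute (pb-isPullback m n) ])
      G3-∧-0ˡ : ∧ ∘ ⟨ δ₀ ∘ ! , id ⟩ ≡ δ₀ ∘ !
      G3-∧-0ʳ : ∧ ∘ ⟨ id , δ₀ ∘ ! ⟩ ≡ δ₀ ∘ !
      G3-∧-1ˡ : ∧ ∘ ⟨ δ₁ ∘ ! , id ⟩ ≡ id
      G3-∧-1ʳ : ∧ ∘ ⟨ id , δ₁ ∘ ! ⟩ ≡ id
      G3-∨-0ˡ : ∨ ∘ ⟨ δ₀ ∘ ! , id ⟩ ≡ id
      G3-∨-0ʳ : ∨ ∘ ⟨ id , δ₀ ∘ ! ⟩ ≡ id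
      G3-∨-1ˡ : ∨ ∘ ⟨ δ₁ ∘ ! , id ⟩ ≡ δ₁ ∘ !
      G3-∨-1ʳ : ∨ ∘ ⟨ id , δ₁ ∘ ! ⟩ ≡ δ₁ ∘ !
      G4 : IsInitial 𝒞 (PB δ₀ δ₁)
      G5₀ : Cof δ₀
      G5₁ : Cof δ₁
      G6 : ∀ {X Y} (f : X ⇒ Y) →
           Σ[ Z ∈ Ob ] Σ[ i ∈ X ⇒ Z ] Σ[ p ∈ Z ⇒ Y ] (Cof i × TrivFib p × p ∘ i ≡ f)
      G7 : ∀ X → Cof (¡ {X})

  module _ {Ũ U : Ob} (El : Ũ ⇒ U) where

    Small : ∀ {X Y} → X ⇒ Y → Set (o ⊔ ℓ)
    Small {X} {Y} f = Σ[ a ∈ Y ⇒ U ] Σ[ b ∈ X ⇒ Ũ ] IsPullback 𝒞 a El f b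

    SmallObj : Ob → Set (o ⊔ ℓ)
    SmallObj X = Small (! {X})

    record Universe : Set (o ⊔ ℓ) where
      field
        iso-small   : ∀ {X Y} (f : X ⇒ Y) → IsIso 𝒞 f → Small f
        comp-small  : ∀ {X Y Z} (f : X ⇒ Y) (g : Y ⇒ Z) → Small f → Small g → Small (g ∘ f)
        Π-small     : ∀ {X Y Z} (p : X ⇒ Y) (g : Y ⇒ Z) → Small p → Small g →
                      Small (DepProduct.π (LCC.depProduct E p g))
        +-small     : ∀ {X Y Z} (f : X ⇒ Z) (g : Y ⇒ Z) → Small f → Small g →
                      Small [ f , g ]
        path-small  : ∀ {X Y} (f : X ⇒ Y) → Small f → Small (pathMap f)

    record HomotopicalUniverse : Set (o ⊔ ℓ ⊔ c) where
      field
        universe   : Universe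
        El-fib     : IsFib El
        U-fibrant  : IsFib (! {U})

-- Since the constant-path map of B is invertible, every path in B is constant, and so is every
-- map 𝕀 × D → B in its 𝕀-coordinate.  Hence a lift against δ ×̂ n is obtained by collapsing 𝕀
-- onto the endpoint δ, and monicity of m makes the upper triangle commute.  For a monomorphism
-- m the paths in a fibre of m are constant, so P_B(A) → A ×_B A is an isomorphism and thus a
-- trivial fibration.  Finally, for discrete B the graph of m is the pullback of the endpoint map
-- P_𝟙(B) → B × B (which is small) along (b , a) ↦ (m a , b), and m is the graph followed by the
-- projection B × A → B (a pullback of A → 𝟙); both are small, hence so is m.
module Submission where

open import Defs
open import Data.Product using (_×_; Σ-syntax; _,_; proj₁; proj₂)
open import Relation.Binary.PropositionalEquality
  using (_≡_; refl; sym; trans; cong; cong₂; subst; module ≡-Reasoning)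

module CategoryLemmas {o ℓ} (𝒞 : Category o ℓ) where
  open Category 𝒞
  open ≡-Reasoning

  pullˡ : ∀ {V W X Y} {a : X ⇒ Y} {b : W ⇒ X} {c : W ⇒ Y} {f : V ⇒ W} →
          a ∘ b ≡ c → a ∘ (b ∘ f) ≡ c ∘ f
  pullˡ {f = f} e = trans (sym assoc) (cong (_∘ f) e)

  pullʳ : ∀ {V W X Y} {a : X ⇒ Y} {b : W ⇒ X} {f : V ⇒ W} {c : V ⇒ X} →
          b ∘ f ≡ c → (a ∘ b) ∘ f ≡ a ∘ c
  pullʳ {a = a} e = trans assoc (cong (a ∘_) e)

  cancelˡ : ∀ {V W X} {a : W ⇒ X} {b : X ⇒ W} {f : V ⇒ X} →
            a ∘ b ≡ id → a ∘ (b ∘ f) ≡ f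
  cancelˡ e = trans (pullˡ e) identityˡ

  iso⇒⧄ : ∀ {A B X Y} {p : X ⇒ Y} → IsIso 𝒞 p → (i : A ⇒ B) → _⧄_ 𝒞 i p
  iso⇒⧄ {p = p} (q , qp , pq) i u v e = q ∘ v , lower , cancelˡ pq
    where
    lower : (q ∘ v) ∘ i ≡ u
    lower = begin
      (q ∘ v) ∘ i  ≡⟨ pullʳ (sym e) ⟩
      q ∘ (p ∘ u)  ≡⟨ cancelˡ qp ⟩
      u            ∎

  IsPullback-paste : ∀ {P X Y Z U V} {a : Y ⇒ U} {e : V ⇒ U} {f : X ⇒ Y} {b : X ⇒ V}
                       {h : Z ⇒ Y} {p : P ⇒ Z} {q : P ⇒ X} →
                     IsPullback 𝒞 a e f b → IsPullback 𝒞 h f p q →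
                     IsPullback 𝒞 (a ∘ h) e p (b ∘ q)
  IsPullback-paste {a = a} {e} {f} {b} {h} {p} {q} outer inner = record
    { commute      = commute
    ; universal    = universal
    ; jointly-mono = jointly-mono
    }
    where
    module O = IsPullback outer
    module I = IsPullback inner

    commute : (a ∘ h) ∘ p ≡ e ∘ (b ∘ q)
    commute = begin
      (a ∘ h) ∘ p  ≡⟨ pullʳ I.commute ⟩
      a ∘ (f ∘ q)  ≡⟨ pullˡ O.commute ⟩
      (e ∘ b) ∘ q  ≡⟨ assoc ⟩
      e ∘ (b ∘ q)  ∎

    universal : ∀ {W} (x : W ⇒ _) (y : W ⇒ _) → (a ∘ h) ∘ x ≡ e ∘ y →
                Σ[ w ∈ W ⇒ _ ] (p ∘ w ≡ x × (b ∘ q) ∘ w ≡ y)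
    universal x y sq with O.universal (h ∘ x) y (trans (sym assoc) sq)
    ... | z , fz , bz with I.universal x z (sym fz)
    ...   | w , pw , qw = w , pw , trans (pullʳ qw) bz

    jointly-mono : ∀ {W} (u v : W ⇒ _) → p ∘ u ≡ p ∘ v → (b ∘ q) ∘ u ≡ (b ∘ q) ∘ v → u ≡ v
    jointly-mono u v pu qu = I.jointly-mono u v pu (O.jointly-mono _ _ fq (trans (sym assoc) (trans qu assoc)))
      where
      fq : f ∘ (q ∘ u) ≡ f ∘ (q ∘ v)
      fq = begin
        f ∘ (q ∘ u)  ≡⟨ pullˡ (sym I.commute) ⟩
        (h ∘ p) ∘ u  ≡⟨ pullʳ pu ⟩
        h ∘ (p ∘ v)  ≡⟨ pullˡ I.commute ⟩
        (f ∘ q) ∘ v  ≡⟨ assoc ⟩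
        f ∘ (q ∘ v)  ∎

module _ {o ℓ c} (S : Setting o ℓ c) where
  open Setting S
  open Category 𝒞
  open LimOps L
  open Interval Int
  open CategoryLemmas 𝒞
  open ≡-Reasoning

  !-unique : ∀ {X} (f g : X ⇒ 𝟙) → f ≡ g
  !-unique = IsTerminal.!-unique (FinLimColim.𝟙-terminal L)

  ×-ext : ∀ {W X Y} (u v : W ⇒ X ×₀ Y) → π₁ ∘ u ≡ π₁ ∘ v → π₂ ∘ u ≡ π₂ ∘ v → u ≡ v
  ×-ext {X = X} {Y} = Product.jointly-mono (FinLimColim.product L X Y)

  pb-commute : ∀ {X Y Z} {f : X ⇒ Z} {g : Y ⇒ Z} → f ∘ pb₁ {f = f} {g} ≡ g ∘ pb₂
  pb-commute {f = f} {g} = IsPullback.commute (pb-isPullback f g)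

  pb-β₁ : ∀ {W X Y Z} {f : X ⇒ Z} {g : Y ⇒ Z} {a : W ⇒ X} {b : W ⇒ Y} {e : f ∘ a ≡ g ∘ b} →
          pb₁ ∘ pb⟨ a , b ⟩[ e ] ≡ a
  pb-β₁ {f = f} {g} {a} {b} {e} = proj₁ (proj₂ (IsPullback.universal (pb-isPullback f g) a b e))

  pb-β₂ : ∀ {W X Y Z} {f : X ⇒ Z} {g : Y ⇒ Z} {a : W ⇒ X} {b : W ⇒ Y} {e : f ∘ a ≡ g ∘ b} →
          pb₂ ∘ pb⟨ a , b ⟩[ e ] ≡ b
  pb-β₂ {f = f} {g} {a} {b} {e} = proj₂ (proj₂ (IsPullback.universal (pb-isPullback f g) a b e))

  pb-ext : ∀ {W X Y Z} {f : X ⇒ Z} {g : Y ⇒ Z} (u v : W ⇒ PB f g) →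
           pb₁ ∘ u ≡ pb₁ ∘ v → pb₂ ∘ u ≡ pb₂ ∘ v → u ≡ v
  pb-ext {f = f} {g} = IsPullback.jointly-mono (pb-isPullback f g)

  po-β₂ : ∀ {Z X Y W} {f : Z ⇒ X} {g : Z ⇒ Y} {a : X ⇒ W} {b : Y ⇒ W} {e : a ∘ f ≡ b ∘ g} →
          po[ a , b ][ e ] ∘ po₂ ≡ b
  po-β₂ {f = f} {g} {a} {b} {e} = proj₂ (proj₂ (IsPushout.universal (po-isPushout f g) a b e))

  swap : ∀ {X Y} → X ×₀ Y ⇒ Y ×₀ X
  swap = ⟨ π₂ , π₁ ⟩

  swap-involutive : ∀ {X Y} → swap ∘ swap {X} {Y} ≡ id
  swap-involutive = ×-ext _ _
    (trans (pullˡ π₁∘⟨⟩) (trans π₂∘⟨⟩ (sym identityʳ)))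
    (trans (pullˡ π₂∘⟨⟩) (trans π₁∘⟨⟩ (sym identityʳ)))

  ⊗id-∘ : ∀ {P Q R T} {a : Q ⇒ R} {b : P ⇒ Q} → (a ∘ b) ⊗ id {T} ≡ (a ⊗ id) ∘ (b ⊗ id)
  ⊗id-∘ {a = a} {b} = trans (cong ((a ∘ b) ⊗_) (sym identityˡ)) (sym ⊗∘⊗)

  ⊗id∘⟨id,⟩ : ∀ {V W X} {t : V ⇒ W} {x : V ⇒ X} → (t ⊗ id) ∘ ⟨ id , x ⟩ ≡ ⟨ t , x ⟩
  ⊗id∘⟨id,⟩ = trans ⟨⟩∘ (cong₂ ⟨_,_⟩ (trans (pullʳ π₁∘⟨⟩) identityʳ) (trans (pullʳ π₂∘⟨⟩) identityˡ))

  π₂∘⊗id : ∀ {X Y D} {f : X ⇒ Y} → π₂ ∘ (f ⊗ id {D}) ≡ π₂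
  π₂∘⊗id = trans π₂∘⟨⟩ identityˡ

  _ᴵ : Obj → Obj
  X ᴵ = _^𝕀 S X

  _ᴵ₁ : ∀ {X Y} → X ⇒ Y → X ᴵ ⇒ Y ᴵ
  f ᴵ₁ = _^𝕀₁ S f

  ev : ∀ {X} → X ᴵ ×₀ 𝕀 ⇒ X
  ev = evalI S

  cur : ∀ {W X} → W ×₀ 𝕀 ⇒ X → W ⇒ X ᴵ
  cur = curryI S

  rᴵ : ∀ X → X ⇒ X ᴵ
  rᴵ = r S

  evAt : ∀ {X} → 𝟙 ⇒ 𝕀 → X ᴵ ⇒ X
  evAt δ = ev ∘ ⟨ id , δ ∘ ! ⟩

  cur-β : ∀ {W X} {h : W ×₀ 𝕀 ⇒ X} → ev ∘ (cur h ⊗ id) ≡ h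
  cur-β {X = X} = Exponential.β (LCC.exponential E X 𝕀)

  ᴵ-ext : ∀ {W X} (t u : W ⇒ X ᴵ) → ev ∘ (t ⊗ id) ≡ ev ∘ (u ⊗ id) → t ≡ u
  ᴵ-ext {X = X} t u e = trans (Exponential.unique (LCC.exponential E X 𝕀) t e)
                              (sym (Exponential.unique (LCC.exponential E X 𝕀) u refl))

  ev∘⊗id : ∀ {W X Y} {f : X ⇒ Y} (t : W ⇒ X ᴵ) → f ∘ (ev ∘ (t ⊗ id)) ≡ ev ∘ ((f ᴵ₁ ∘ t) ⊗ id)
  ev∘⊗id {f = f} t = begin
    f ∘ (ev ∘ (t ⊗ id))           ≡⟨ pullˡ (sym cur-β) ⟩
    (ev ∘ (f ᴵ₁ ⊗ id)) ∘ (t ⊗ id) ≡⟨ pullʳ (sym ⊗id-∘) ⟩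
    ev ∘ ((f ᴵ₁ ∘ t) ⊗ id)        ∎

  evAt∘cur : ∀ {W X} (δ : 𝟙 ⇒ 𝕀) (h : W ×₀ 𝕀 ⇒ X) → evAt δ ∘ cur h ≡ h ∘ ⟨ id , δ ∘ ! ⟩
  evAt∘cur δ h = begin
    (ev ∘ ⟨ id , δ ∘ ! ⟩) ∘ cur h      ≡⟨ pullʳ (trans ⟨⟩∘ (cong₂ ⟨_,_⟩ identityˡ (pullʳ (!-unique _ _)))) ⟩
    ev ∘ ⟨ cur h , δ ∘ ! ⟩             ≡⟨ cong (ev ∘_) (sym ⊗id∘⟨id,⟩) ⟩
    ev ∘ ((cur h ⊗ id) ∘ ⟨ id , δ ∘ ! ⟩) ≡⟨ pullˡ cur-β ⟩
    h ∘ ⟨ id , δ ∘ ! ⟩                 ∎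

  evAt-rᴵ : ∀ {X} (δ : 𝟙 ⇒ 𝕀) → evAt δ ∘ rᴵ X ≡ id
  evAt-rᴵ δ = trans (evAt∘cur δ π₁) π₁∘⟨⟩

  evAt-natural : ∀ {X Y} {f : X ⇒ Y} (δ : 𝟙 ⇒ 𝕀) → evAt δ ∘ f ᴵ₁ ≡ f ∘ evAt δ
  evAt-natural δ = trans (evAt∘cur δ _) assoc

  rᴵ-natural : ∀ {X Y} (f : X ⇒ Y) → f ᴵ₁ ∘ rᴵ X ≡ rᴵ Y ∘ f
  rᴵ-natural {X} {Y} f = ᴵ-ext _ _ (begin
    ev ∘ ((f ᴵ₁ ∘ rᴵ X) ⊗ id)       ≡⟨ sym (ev∘⊗id (rᴵ X)) ⟩
    f ∘ (ev ∘ (rᴵ X ⊗ id))          ≡⟨ cong (f ∘_) cur-β ⟩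
    f ∘ π₁                          ≡⟨ sym π₁∘⟨⟩ ⟩
    π₁ ∘ (f ⊗ id)                   ≡⟨ cong (_∘ (f ⊗ id)) (sym cur-β) ⟩
    (ev ∘ (rᴵ Y ⊗ id)) ∘ (f ⊗ id)   ≡⟨ pullʳ (sym ⊗id-∘) ⟩
    ev ∘ ((rᴵ Y ∘ f) ⊗ id)          ∎)

  ᴵ₁-mono : ∀ {X Y} {f : X ⇒ Y} → Mono 𝒞 f → Mono 𝒞 (f ᴵ₁)
  ᴵ₁-mono {f = f} mono t u e = ᴵ-ext t u (mono _ _ (begin
    f ∘ (ev ∘ (t ⊗ id))     ≡⟨ ev∘⊗id t ⟩
    ev ∘ ((f ᴵ₁ ∘ t) ⊗ id)  ≡⟨ cong (λ s → ev ∘ (s ⊗ id)) e ⟩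
    ev ∘ ((f ᴵ₁ ∘ u) ⊗ id)  ≡⟨ sym (ev∘⊗id u) ⟩
    f ∘ (ev ∘ (u ⊗ id))     ∎))

  discrete-evAt : ∀ {X} (disc : Discrete S X) (δ : 𝟙 ⇒ 𝕀) → evAt δ ≡ proj₁ disc
  discrete-evAt (g , _ , rg) δ = begin
    evAt δ              ≡⟨ sym identityʳ ⟩
    evAt δ ∘ id         ≡⟨ cong (evAt δ ∘_) (sym rg) ⟩
    evAt δ ∘ (rᴵ _ ∘ g) ≡⟨ cancelˡ (evAt-rᴵ δ) ⟩
    g                   ∎

  discrete-rᴵ∘evAt : ∀ {X} → Discrete S X → (δ : 𝟙 ⇒ 𝕀) → rᴵ X ∘ evAt δ ≡ id
  discrete-rᴵ∘evAt disc δ = trans (cong (rᴵ _ ∘_) (discrete-evAt disc δ)) (proj₂ (proj₂ disc))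

  discrete-π₁-factor : ∀ {W X} → Discrete S X → (w : W ×₀ 𝕀 ⇒ X) → Σ[ s ∈ W ⇒ X ] w ≡ s ∘ π₁
  discrete-π₁-factor {W} {X} disc w = s , (begin
    w                             ≡⟨ sym cur-β ⟩
    ev ∘ (cur w ⊗ id)             ≡⟨ cong (λ t → ev ∘ (t ⊗ id)) (sym (cancelˡ (discrete-rᴵ∘evAt disc δ₀))) ⟩
    ev ∘ ((rᴵ X ∘ s) ⊗ id)        ≡⟨ cong (ev ∘_) ⊗id-∘ ⟩
    ev ∘ ((rᴵ X ⊗ id) ∘ (s ⊗ id)) ≡⟨ pullˡ cur-β ⟩
    π₁ ∘ (s ⊗ id)                 ≡⟨ π₁∘⟨⟩ ⟩
    s ∘ π₁                        ∎)
    where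
    s : W ⇒ X
    s = evAt δ₀ ∘ cur w

  discrete-π₂-factor : ∀ {D X} → Discrete S X → (v : 𝕀 ×₀ D ⇒ X) → Σ[ s ∈ D ⇒ X ] v ≡ s ∘ π₂
  discrete-π₂-factor disc v with discrete-π₁-factor disc (v ∘ swap)
  ... | s , v∘swap≡ = s , (begin
    v                  ≡⟨ sym identityʳ ⟩
    v ∘ id             ≡⟨ cong (v ∘_) (sym swap-involutive) ⟩
    v ∘ (swap ∘ swap)  ≡⟨ pullˡ v∘swap≡ ⟩
    (s ∘ π₁) ∘ swap    ≡⟨ pullʳ π₁∘⟨⟩ ⟩
    s ∘ π₂             ∎)

  mono-into-discrete-⧄ : ∀ {A B C D} {m : A ⇒ B} → Mono 𝒞 m → Discrete S B →
                         (δ : 𝟙 ⇒ 𝕀) (n : C ⇒ D) → _⧄_ 𝒞 (δ ×̂ n) m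
  mono-into-discrete-⧄ {A} {B} {D = D} {m} mono disc δ n u v e = d , upper , lower
    where
    d : 𝕀 ×₀ D ⇒ A
    d = u ∘ (po₂ ∘ ⟨ ! , π₂ ⟩)

    s : D ⇒ B
    s = proj₁ (discrete-π₂-factor disc v)

    v≡ : v ≡ s ∘ π₂
    v≡ = proj₂ (discrete-π₂-factor disc v)

    lower : m ∘ d ≡ v
    lower = begin
      m ∘ (u ∘ (po₂ ∘ ⟨ ! , π₂ ⟩))            ≡⟨ pullˡ e ⟩
      (v ∘ (δ ×̂ n)) ∘ (po₂ ∘ ⟨ ! , π₂ ⟩)     ≡⟨ pullʳ (pullˡ po-β₂) ⟩
      v ∘ ((δ ⊗ id) ∘ ⟨ ! , π₂ ⟩)            ≡⟨ cong (_∘ ((δ ⊗ id) ∘ ⟨ ! , π₂ ⟩)) v≡ ⟩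
      (s ∘ π₂) ∘ ((δ ⊗ id) ∘ ⟨ ! , π₂ ⟩)     ≡⟨ pullʳ (trans (pullˡ π₂∘⊗id) π₂∘⟨⟩) ⟩
      s ∘ π₂                                 ≡⟨ sym v≡ ⟩
      v                                      ∎

    upper : d ∘ (δ ×̂ n) ≡ u
    upper = mono _ _ (begin
      m ∘ (d ∘ (δ ×̂ n))  ≡⟨ pullˡ lower ⟩
      v ∘ (δ ×̂ n)        ≡⟨ sym e ⟩
      m ∘ u              ∎)

  mono-into-discrete-isFib : ∀ {A B} {m : A ⇒ B} → Mono 𝒞 m → Discrete S B → IsFib S m
  mono-into-discrete-isFib mono disc n _ =
    mono-into-discrete-⧄ mono disc δ₀ n , mono-into-discrete-⧄ mono disc δ₁ n

  module _ {X Y} (f : X ⇒ Y) where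

    constPath : X ⇒ PathObj S f
    constPath = pb⟨ rᴵ X , f ⟩[ rᴵ-natural f ]

    PathObj-endpoint : (δ : 𝟙 ⇒ 𝕀) → f ∘ (evAt δ ∘ pb₁) ≡ pb₂ {f = f ᴵ₁} {rᴵ Y}
    PathObj-endpoint δ = begin
      f ∘ (evAt δ ∘ pb₁)     ≡⟨ pullˡ (sym (evAt-natural δ)) ⟩
      (evAt δ ∘ f ᴵ₁) ∘ pb₁  ≡⟨ pullʳ pb-commute ⟩
      evAt δ ∘ (rᴵ Y ∘ pb₂)  ≡⟨ cancelˡ (evAt-rᴵ δ) ⟩
      pb₂                    ∎

    constPath-endpoint : (δ : 𝟙 ⇒ 𝕀) → (evAt δ ∘ pb₁) ∘ constPath ≡ id
    constPath-endpoint δ = trans (pullʳ pb-β₁) (evAt-rᴵ δ)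

    pathMap-constPath₁ : ∀ {W} (t : W ⇒ X) → pb₁ ∘ (pathMap S f ∘ (constPath ∘ t)) ≡ t
    pathMap-constPath₁ t = trans (pullˡ pb-β₁) (cancelˡ (constPath-endpoint δ₀))

    pathMap-constPath₂ : ∀ {W} (t : W ⇒ X) → pb₂ ∘ (pathMap S f ∘ (constPath ∘ t)) ≡ t
    pathMap-constPath₂ t = trans (pullˡ pb-β₂) (cancelˡ (constPath-endpoint δ₁))

  module _ {A B} {m : A ⇒ B} (mono : Mono 𝒞 m) where

    mono-path-constant : pb₁ ≡ rᴵ A ∘ (evAt δ₀ ∘ pb₁ {f = m ᴵ₁} {rᴵ B})
    mono-path-constant = ᴵ₁-mono mono _ _ (begin
      m ᴵ₁ ∘ pb₁                         ≡⟨ pb-commute ⟩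
      rᴵ B ∘ pb₂                         ≡⟨ cong (rᴵ B ∘_) (sym (PathObj-endpoint m δ₀)) ⟩
      rᴵ B ∘ (m ∘ (evAt δ₀ ∘ pb₁))       ≡⟨ pullˡ (sym (rᴵ-natural m)) ⟩
      (m ᴵ₁ ∘ rᴵ A) ∘ (evAt δ₀ ∘ pb₁)    ≡⟨ assoc ⟩
      m ᴵ₁ ∘ (rᴵ A ∘ (evAt δ₀ ∘ pb₁))    ∎)

    mono-pathMap-iso : IsIso 𝒞 (pathMap S m)
    mono-pathMap-iso = constPath m ∘ pb₁ , left-inverse , right-inverse
      where
      left-inverse : (constPath m ∘ pb₁) ∘ pathMap S m ≡ id
      left-inverse = trans (pullʳ pb-β₁) (pb-ext _ _
        (trans (pullˡ pb-β₁) (trans (sym mono-path-constant) (sym identityʳ)))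
        (trans (pullˡ pb-β₂) (trans (PathObj-endpoint m δ₀) (sym identityʳ))))

      right-inverse : pathMap S m ∘ (constPath m ∘ pb₁) ≡ id
      right-inverse = pb-ext _ _
        (trans (pathMap-constPath₁ m pb₁) (sym identityʳ))
        (trans (pathMap-constPath₂ m pb₁) (trans (mono _ _ pb-commute) (sym identityʳ)))

    mono-into-discrete-isHProp : Discrete S B → IsHProp S m
    mono-into-discrete-isHProp disc =
      mono-into-discrete-isFib mono disc , λ n _ → iso⇒⧄ mono-pathMap-iso n

  module _ {Ũ U} (El : Ũ ⇒ U) where

    Small-pullback : ∀ {X Y Z P} {f : X ⇒ Y} {h : Z ⇒ Y} {p : P ⇒ Z} {q : P ⇒ X} →
                     Small S El f → IsPullback 𝒞 h f p q → Small S El p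
    Small-pullback {h = h} {q = q} (a , b , isPb) sq = a ∘ h , b ∘ q , IsPullback-paste isPb sq

  module _ {A B} (m : A ⇒ B) where

    graph : A ⇒ PB (! {B}) (! {A})
    graph = pb⟨ m , id ⟩[ !-unique _ _ ]

    twist : PB (! {B}) (! {A}) ⇒ PB (! {B}) (! {B})
    twist = pb⟨ m ∘ pb₂ , pb₁ ⟩[ !-unique _ _ ]

    graph-isPullback : Discrete S B →
                       IsPullback 𝒞 twist (pathMap S (! {B})) graph (constPath ! ∘ m)
    graph-isPullback disc = record
      { commute      = commute
      ; universal    = universal
      ; jointly-mono = jointly-mono
      }
      where
      commute : twist ∘ graph ≡ pathMap S ! ∘ (constPath ! ∘ m)
      commute = pb-ext _ _
        (trans (pullˡ pb-β₁) (trans (pullʳ pb-β₂) (trans identityʳ (sym (pathMap-constPath₁ ! m)))))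
        (trans (pullˡ pb-β₂) (trans pb-β₁ (sym (pathMap-constPath₂ ! m))))

      universal : ∀ {W} (x : W ⇒ PB (! {B}) (! {A})) (y : W ⇒ PathObj S (! {B})) →
                  twist ∘ x ≡ pathMap S ! ∘ y →
                  Σ[ w ∈ W ⇒ A ] (graph ∘ w ≡ x × (constPath ! ∘ m) ∘ w ≡ y)
      universal {W} x y e = pb₂ ∘ x , graph-w , constPath-w
        where
        z : W ⇒ B
        z = evAt δ₀ ∘ (pb₁ ∘ y)

        path-constant : pb₁ ∘ y ≡ rᴵ B ∘ z
        path-constant = sym (cancelˡ (discrete-rᴵ∘evAt disc δ₀))

        endpoints-agree : evAt δ₁ ∘ (pb₁ ∘ y) ≡ z
        endpoints-agree = cong (_∘ (pb₁ ∘ y)) (trans (discrete-evAt disc δ₁) (sym (discrete-evAt disc δ₀)))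

        m∘w≡z : m ∘ (pb₂ ∘ x) ≡ z
        m∘w≡z = begin
          m ∘ (pb₂ ∘ x)             ≡⟨ pullˡ (sym pb-β₁) ⟩
          (pb₁ ∘ twist) ∘ x         ≡⟨ pullʳ e ⟩
          pb₁ ∘ (pathMap S ! ∘ y)   ≡⟨ pullˡ pb-β₁ ⟩
          (evAt δ₀ ∘ pb₁) ∘ y       ≡⟨ assoc ⟩
          z                         ∎

        pb₁∘x≡z : pb₁ ∘ x ≡ z
        pb₁∘x≡z = begin
          pb₁ ∘ x                   ≡⟨ cong (_∘ x) (sym pb-β₂) ⟩
          (pb₂ ∘ twist) ∘ x         ≡⟨ pullʳ e ⟩
          pb₂ ∘ (pathMap S ! ∘ y)   ≡⟨ pullˡ pb-β₂ ⟩
          (evAt δ₁ ∘ pb₁) ∘ y       ≡⟨ assoc ⟩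
          evAt δ₁ ∘ (pb₁ ∘ y)       ≡⟨ endpoints-agree ⟩
          z                         ∎

        graph-w : graph ∘ (pb₂ ∘ x) ≡ x
        graph-w = pb-ext _ _ (trans (pullˡ pb-β₁) (trans m∘w≡z (sym pb₁∘x≡z)))
                             (trans (pullˡ pb-β₂) identityˡ)

        constPath-w : (constPath ! ∘ m) ∘ (pb₂ ∘ x) ≡ y
        constPath-w = pb-ext _ _
          (begin
            pb₁ ∘ ((constPath ! ∘ m) ∘ (pb₂ ∘ x))  ≡⟨ cong (pb₁ ∘_) assoc ⟩
            pb₁ ∘ (constPath ! ∘ (m ∘ (pb₂ ∘ x)))  ≡⟨ pullˡ pb-β₁ ⟩
            rᴵ B ∘ (m ∘ (pb₂ ∘ x))                 ≡⟨ cong (rᴵ B ∘_) m∘w≡z ⟩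
            rᴵ B ∘ z                               ≡⟨ sym path-constant ⟩
            pb₁ ∘ y                                ∎)
          (!-unique _ _)

      jointly-mono : ∀ {W} (u v : W ⇒ A) → graph ∘ u ≡ graph ∘ v →
                     (constPath ! ∘ m) ∘ u ≡ (constPath ! ∘ m) ∘ v → u ≡ v
      jointly-mono u v e _ = begin
        u                  ≡⟨ sym (cancelˡ pb-β₂) ⟩
        pb₂ ∘ (graph ∘ u)  ≡⟨ cong (pb₂ ∘_) e ⟩
        pb₂ ∘ (graph ∘ v)  ≡⟨ cancelˡ pb-β₂ ⟩
        v                  ∎

    Small-into-discrete : ∀ {Ũ U} {El : Ũ ⇒ U} → Universe S El →
                          SmallObj S El A → SmallObj S El B → Discrete S B → Small S El m
    Small-into-discrete {El = El} univ smallA smallB disc =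
      subst (Small S El) pb-β₁ (comp-small graph pb₁ small-graph small-projection)
      where
      open Universe univ
      small-graph : Small S El graph
      small-graph = Small-pullback El (path-small ! smallB) (graph-isPullback disc)
      small-projection : Small S El (pb₁ {f = ! {B}} {g = ! {A}})
      small-projection = Small-pullback El smallA (pb-isPullback ! !)

mainTheorem10 : ∀ {o ℓ c} (S : Setting o ℓ c) → GeneralConditions S →
                ∀ {Ũ U : Ob S} (El : Hom S Ũ U) → HomotopicalUniverse S El →
                ∀ {A B : Ob S} (m : Hom S A B) →
                Cofibration S m → Mono (Setting.𝒞 S) m →
                SmallObj S El A → SmallObj S El B → Discrete S B →
                Small S El m × IsFib S m × IsHProp S m
mainTheorem10 S _ El homotopical m _ mono smallA smallB disc =
  Small-into-discrete S m (HomotopicalUniverse.universe homotopical) smallA smallB disc ,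
  mono-into-discrete-isFib S mono disc ,
  mono-into-discrete-isHProp S mono disc
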